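{- Let $S$ be a simplicial complex of dimension $d\geq 0$. (i) If $S$ is paving, then $S$ is a near-matroid. (ii) If $S$ is boolean representable and $d\leq 2$, then $S$ is a near-matroid.
   Context: A (finite) simplicial complex is a pair $S=(V,\mathcal{H})$ where $V$ is a finite nonempty set and $\mathcal{H}\subseteq 2^V$ contains all singletons and is closed under taking subsets. Its dimension is $\max\{|I|:I\in\mathcal{H}\}-1$. $P_n(V)$ is the set of subsets of $V$ of size $n$. $S$ is paving if $P_{\dim S}(V)\subseteq\mathcal{H}$. A flat of $S$ is $X\subseteq V$ with $I\cup\{p\}\in\mathcal{H}$ for all $I\in\mathcal{H}\cap 2^X$ and $p\in V\setminus X$; the closure $\overline{X}$ of $X\subseteq V$ is the intersection of all flats containing $X$. $S$ is a near-matroid if for all $X,Y\in\mathcal{H}$, $\overline{X}=\overline{Y}\subsetneq V$ implies $|X|=|Y|$. $S$ is boolean representable if there is a boolean matrix $M$ with columns indexed by $V$ such that $\mathcal{H}$ is exactly the set of $X\subseteq V$ for which some square submatrix with column set $X$ is congruent (by permuting rows and columns) to a lower unitriangular boolean matrix. -}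

module Defs where

open import Data.Nat using (ℕ; suc; _≤_; _<_)
open import Data.Bool using (Bool; true; false)
open import Data.Fin using (Fin)
import Data.Fin as F
open import Data.Fin.Subset using (Subset; _∈_; _∉_; _⊆_; _∪_; ⁅_⁆; ∣_∣)
open import Data.Product using (Σ; ∃; _×_; _,_)
open import Relation.Binary.PropositionalEquality using (_≡_)
open import Relation.Nullary using (¬_)
open import Function.Definitions using (Injective)
open import Function.Bundles using (_⇔_)

-- A simplicial complex on the vertex set V = Fin n (finite; nonemptiness is
-- imposed in the statement by taking n = suc k).
record SimplicialComplex (n : ℕ) : Set₁ where
  field
    H          : Subset n → Set
    singletons : ∀ (p : Fin n) → H ⁅ p ⁆
    downClosed : ∀ {X Y : Subset n} → X ⊆ Y → H Y → H X

module _ {n : ℕ} (S : SimplicialComplex n) where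
  open SimplicialComplex S

  HasDim : ℕ → Set
  HasDim d = (Σ (Subset n) λ I → H I × ∣ I ∣ ≡ suc d)
           × (∀ I → H I → ∣ I ∣ ≤ suc d)

  Paving : ℕ → Set
  Paving d = ∀ (X : Subset n) → ∣ X ∣ ≡ d → H X

  IsFlat : Subset n → Set
  IsFlat X = ∀ (I : Subset n) (p : Fin n) → H I → I ⊆ X → p ∉ X → H (I ∪ ⁅ p ⁆)

  _∈cl_ : Fin n → Subset n → Set
  p ∈cl X = ∀ (F : Subset n) → IsFlat F → X ⊆ F → p ∈ F

  NearMatroid : Set
  NearMatroid = ∀ (X Y : Subset n) → H X → H Y →
    (∀ p → (p ∈cl X) ⇔ (p ∈cl Y)) →
    (Σ (Fin n) λ p → ¬ (p ∈cl X)) →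
    ∣ X ∣ ≡ ∣ Y ∣

  LowerUnitriangularOn : {m : ℕ} → (Fin m → Fin n → Bool) → Subset n → Set
  LowerUnitriangularOn {m} M X =
    Σ ℕ λ k → Σ (Fin k → Fin m) λ r → Σ (Fin k → Fin n) λ c →
      Injective _≡_ _≡_ r × Injective _≡_ _≡_ c ×
      (∀ q → (q ∈ X) ⇔ (Σ (Fin k) λ j → c j ≡ q)) ×
      (∀ i → M (r i) (c i) ≡ true) ×
      (∀ i j → i F.< j → M (r i) (c j) ≡ false)

  BooleanRepresentable : Set
  BooleanRepresentable =
    Σ ℕ λ m → Σ (Fin m → Fin n → Bool) λ M →
      ∀ (X : Subset n) → H X ⇔ LowerUnitriangularOn M X

-- An independent set X whose closure is proper has at most d elements: one of
-- size d + 1 spans V, since adding a point outside a flat containing it would give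
-- an independent set of size d + 2. So two independent sets with the same proper
-- closure have equal size once, for some t ≥ d, every independent X with |X| < t
-- is at least as large as each independent set inside its closure; this holds if
-- X lies in a flat with no larger independent subsets. For a paving complex every
-- set of size < d is itself a flat (t = d). For a boolean representation (t = 2)
-- the empty set is a flat, and so is the set of columns equal to a given column:
-- it contains at most one element of each independent set, because distinct
-- columns of a lower unitriangular submatrix differ, while two different columns
-- always form a lower unitriangular 2 × 2 submatrix, every column having a 1.

module Submission where

open import Defs
open import Data.Nat using (ℕ; suc; _≤_; _<_; _≤?_; z≤n; s≤s)
open import Data.Nat.Properties
  using (≤-refl; <-irrefl; <⇒≤; n≤1+n; ≤-trans; ≤-<-trans; ≤-antisym; ≤-pred; n≤0⇒n≡0; ≰⇒>; <⇒≱; ≤∧≢⇒<; m≤n⇒m<n∨m≡n)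
open import Data.Product using (∃; _×_; _,_; proj₁; proj₂)
open import Data.Sum using (_⊎_; inj₁; inj₂)
open import Data.Bool using (Bool; true; false)
import Data.Bool.Properties as Bool
open import Data.Fin using (Fin; zero; suc)
import Data.Fin as Fin
open import Data.Fin.Properties using (<-cmp; all?; ¬∀⟶∃¬)
open import Data.Fin.Subset using (Subset; inside; outside; _∈_; _∉_; _⊆_; _∪_; ⁅_⁆; ∣_∣; Empty)
open import Data.Fin.Subset.Properties
  using ( _∈?_; ⊆-refl; ⊆-trans; s⊆s; out⊆; p⊆p∪q; x∈p∪q⁺; x∈p∪q⁻; x∈⁅x⁆; x∈⁅y⁆⇒x≡y; x≢y⇒x∉⁅y⁆; ∣⁅x⁆∣≡1
        ; p⊆q⇒∣p∣≤∣q∣; p⊂q⇒∣p∣<∣q∣; ∣p∣≤n; ∣⊥∣≡0; ∪-comm; ∪-identityˡ; ∪-identityʳ; nonempty?; Empty-unique)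
open import Data.Vec using (_∷_; []; tabulate; lookup)
open import Data.Vec.Properties using (lookup∘tabulate; []=⇒lookup; lookup⇒[]=)
open import Function using (_∘_)
open import Function.Bundles using (_⇔_; mk⇔; Equivalence)
open import Function.Definitions using (Injective)
open import Relation.Binary.Core using (Rel)
open import Relation.Binary.Definitions using (Symmetric; tri<; tri≈; tri>)
open import Relation.Binary.PropositionalEquality using (_≡_; refl; sym; trans; cong; subst; subst₂)
open import Relation.Nullary using (¬_; Dec; yes; no; does; contradiction)
open import Relation.Nullary.Decidable using (dec-true)

open Equivalence

≤-antisym-under : ∀ {a b t} → a ≤ t → b ≤ t → (a < t → b ≤ a) → (b < t → a ≤ b) → a ≡ b
≤-antisym-under a≤t b≤t b≤a a≤b with m≤n⇒m<n∨m≡n a≤t | m≤n⇒m<n∨m≡n b≤t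
... | inj₁ a<t | _ = ≤-antisym (a≤b (≤-<-trans (b≤a a<t) a<t)) (b≤a a<t)
... | _ | inj₁ b<t = ≤-antisym (a≤b b<t) (b≤a (≤-<-trans (a≤b b<t) b<t))
... | inj₂ refl | inj₂ refl = refl

<2⇒≡0⊎≡1 : ∀ {a} → a < 2 → a ≡ 0 ⊎ a ≡ 1
<2⇒≡0⊎≡1 {0} _ = inj₁ refl
<2⇒≡0⊎≡1 {1} _ = inj₂ refl
<2⇒≡0⊎≡1 {suc (suc _)} (s≤s (s≤s ()))

<-excluded⇒≡ : ∀ {k ℓ} {R : Rel (Fin k) ℓ} → Symmetric R →
               (∀ {i j} → i Fin.< j → ¬ R i j) → ∀ {i j} → R i j → i ≡ j
<-excluded⇒≡ R-sym excluded {i} {j} Rij with <-cmp i j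
... | tri< i<j _ _ = contradiction Rij (excluded i<j)
... | tri≈ _ i≡j _ = i≡j
... | tri> _ _ j<i = contradiction (R-sym Rij) (excluded j<i)

does≡true⇒ : ∀ {a} {A : Set a} (a? : Dec A) → does a? ≡ true → A
does≡true⇒ (yes a) _ = a
does≡true⇒ (no _) ()

∈tabulate⇔ : ∀ {n} {f : Fin n → Bool} {a} → a ∈ tabulate f ⇔ f a ≡ true
∈tabulate⇔ {f = f} {a} = mk⇔
  (λ a∈ → trans (sym (lookup∘tabulate f a)) ([]=⇒lookup a∈))
  (λ fa≡true → lookup⇒[]= a _ (trans (lookup∘tabulate f a) fa≡true))

∣p∪⁅x⁆∣≤1+∣p∣ : ∀ {n} (p : Subset n) (x : Fin n) → ∣ p ∪ ⁅ x ⁆ ∣ ≤ suc ∣ p ∣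
∣p∪⁅x⁆∣≤1+∣p∣ (inside ∷ p) zero rewrite ∪-identityʳ p = n≤1+n _
∣p∪⁅x⁆∣≤1+∣p∣ (outside ∷ p) zero rewrite ∪-identityʳ p = ≤-refl
∣p∪⁅x⁆∣≤1+∣p∣ (inside ∷ p) (suc x) = s≤s (∣p∪⁅x⁆∣≤1+∣p∣ p x)
∣p∪⁅x⁆∣≤1+∣p∣ (outside ∷ p) (suc x) = ∣p∪⁅x⁆∣≤1+∣p∣ p x

x∉p⇒∣p∣<∣p∪⁅x⁆∣ : ∀ {n} {p : Subset n} {x} → x ∉ p → ∣ p ∣ < ∣ p ∪ ⁅ x ⁆ ∣
x∉p⇒∣p∣<∣p∪⁅x⁆∣ {p = p} {x} x∉p =
  p⊂q⇒∣p∣<∣q∣ (p⊆p∪q ⁅ x ⁆ , x , x∈p∪q⁺ (inj₂ (x∈⁅x⁆ x)) , x∉p)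

x∈p⇒⁅x⁆⊆p : ∀ {n} {p : Subset n} {x} → x ∈ p → ⁅ x ⁆ ⊆ p
x∈p⇒⁅x⁆⊆p {p = p} {x} x∈p y∈⁅x⁆ = subst (_∈ p) (sym (x∈⁅y⁆⇒x≡y x y∈⁅x⁆)) x∈p

∣p∣≡0⇒Empty : ∀ {n} {p : Subset n} → ∣ p ∣ ≡ 0 → Empty p
∣p∣≡0⇒Empty ∣p∣≡0 (x , x∈p) =
  contradiction (subst₂ _≤_ (∣⁅x⁆∣≡1 x) ∣p∣≡0 (p⊆q⇒∣p∣≤∣q∣ (x∈p⇒⁅x⁆⊆p x∈p))) λ ()

Empty⇒∣p∣≡0 : ∀ {n} {p : Subset n} → Empty p → ∣ p ∣ ≡ 0
Empty⇒∣p∣≡0 {n} p-empty rewrite Empty-unique p-empty = ∣⊥∣≡0 n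

∣p∣≡1⇒⊆⁅x⁆ : ∀ {n} {p : Subset n} → ∣ p ∣ ≡ 1 → ∃ λ x → p ⊆ ⁅ x ⁆
∣p∣≡1⇒⊆⁅x⁆ {p = p} ∣p∣≡1 with nonempty? p
... | no p-empty = contradiction (trans (sym (Empty⇒∣p∣≡0 p-empty)) ∣p∣≡1) λ ()
... | yes (x , x∈p) = x , λ {y} y∈p → only-x y y∈p
  where
  only-x : ∀ y → y ∈ p → y ∈ ⁅ x ⁆
  only-x y y∈p with y Fin.≟ x
  ... | yes refl = x∈⁅x⁆ x
  ... | no y≢x = contradiction (subst₂ _<_ (∣⁅x⁆∣≡1 x) ∣p∣≡1
                   (p⊂q⇒∣p∣<∣q∣ (x∈p⇒⁅x⁆⊆p x∈p , y , y∈p , x≢y⇒x∉⁅y⁆ y≢x))) (<-irrefl refl)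

subsingleton⇒∣p∣≤1 : ∀ {n} {p : Subset n} → (∀ {x y} → x ∈ p → y ∈ p → x ≡ y) → ∣ p ∣ ≤ 1
subsingleton⇒∣p∣≤1 {p = p} subsingleton with nonempty? p
... | no p-empty = subst (_≤ 1) (sym (Empty⇒∣p∣≡0 p-empty)) z≤n
... | yes (x , x∈p) = subst (∣ p ∣ ≤_) (∣⁅x⁆∣≡1 x)
      (p⊆q⇒∣p∣≤∣q∣ λ y∈p → subst (_∈ ⁅ x ⁆) (subsingleton x∈p y∈p) (x∈⁅x⁆ x))

extend-to-size : ∀ {n k} (p : Subset n) → ∣ p ∣ ≤ k → k ≤ n → ∃ λ q → p ⊆ q × ∣ q ∣ ≡ k
extend-to-size {k = 0} p ∣p∣≤0 _ = p , ⊆-refl , n≤0⇒n≡0 ∣p∣≤0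
extend-to-size {k = suc k} (inside ∷ p) (s≤s ∣p∣≤k) (s≤s k≤n) with extend-to-size p ∣p∣≤k k≤n
... | q , p⊆q , ∣q∣≡k = inside ∷ q , s⊆s p⊆q , cong suc ∣q∣≡k
extend-to-size {k = suc k} (outside ∷ p) ∣p∣≤1+k (s≤s k≤n) with ∣ p ∣ ≤? k
... | no ∣p∣≰k = outside ∷ p , ⊆-refl , ≤-antisym ∣p∣≤1+k (≰⇒> ∣p∣≰k)
... | yes ∣p∣≤k with extend-to-size p ∣p∣≤k k≤n
...   | q , p⊆q , ∣q∣≡k = inside ∷ q , out⊆ p⊆q , cong suc ∣q∣≡k

module _ {n : ℕ} (S : SimplicialComplex n) where
  open SimplicialComplex S

  _⊆cl_ : Subset n → Subset n → Set
  Y ⊆cl X = ∀ {y} → y ∈ Y → _∈cl_ S y X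

  SpanBoundedBelow : ℕ → Set
  SpanBoundedBelow t = ∀ {X Y} → H X → H Y → ∣ X ∣ < t → Y ⊆cl X → ∣ Y ∣ ≤ ∣ X ∣

  ⊆-cl : ∀ {X} → X ⊆cl X
  ⊆-cl x∈X F _ X⊆F = X⊆F x∈X

  flat-spanBound : ∀ {F Y} → IsFlat S F → Y ⊆cl F → ∣ Y ∣ ≤ ∣ F ∣
  flat-spanBound F-flat Y⊆clF = p⊆q⇒∣p∣≤∣q∣ λ y∈Y → Y⊆clF y∈Y _ F-flat ⊆-refl

  Empty∪⁅q⁆-independent : ∀ {I} q → Empty I → H (I ∪ ⁅ q ⁆)
  Empty∪⁅q⁆-independent q I-empty rewrite Empty-unique I-empty | ∪-identityˡ ⁅ q ⁆ = singletons q

  Empty-isFlat : ∀ {X} → Empty X → IsFlat S X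
  Empty-isFlat X-empty I q _ I⊆X _ = Empty∪⁅q⁆-independent q λ (x , x∈I) → X-empty (x , I⊆X x∈I)

  module _ {d} (dim : HasDim S d) where

    d<n : d < n
    d<n with proj₁ dim
    ... | I , _ , ∣I∣≡1+d = subst (_≤ n) ∣I∣≡1+d (∣p∣≤n I)

    maximum-spans : ∀ {X} → H X → ∣ X ∣ ≡ suc d → ∀ p → _∈cl_ S p X
    maximum-spans {X} HX ∣X∣≡1+d p F F-flat X⊆F with p ∈? F
    ... | yes p∈F = p∈F
    ... | no p∉F = contradiction (proj₂ dim _ (F-flat X p HX X⊆F p∉F))
                     (<⇒≱ (subst (_< ∣ X ∪ ⁅ p ⁆ ∣) ∣X∣≡1+d (x∉p⇒∣p∣<∣p∪⁅x⁆∣ (p∉F ∘ X⊆F))))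

    nonspanning⇒∣X∣≤d : ∀ {X p} → H X → ¬ _∈cl_ S p X → ∣ X ∣ ≤ d
    nonspanning⇒∣X∣≤d HX p∉clX =
      ≤-pred (≤∧≢⇒< (proj₂ dim _ HX) λ ∣X∣≡1+d → p∉clX (maximum-spans HX ∣X∣≡1+d _))

    nearMatroid-if-spanBounded : ∀ {t} → d ≤ t → SpanBoundedBelow t → NearMatroid S
    nearMatroid-if-spanBounded d≤t spanBounded X Y HX HY clX⇔clY (p , p∉clX) =
      ≤-antisym-under (≤-trans ∣X∣≤d d≤t) (≤-trans ∣Y∣≤d d≤t)
        (λ ∣X∣<t → spanBounded HX HY ∣X∣<t Y⊆clX)
        (λ ∣Y∣<t → spanBounded HY HX ∣Y∣<t X⊆clY)
      where
      Y⊆clX : Y ⊆cl X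
      Y⊆clX {y} y∈Y = from (clX⇔clY y) (⊆-cl y∈Y)
      X⊆clY : X ⊆cl Y
      X⊆clY {x} x∈X = to (clX⇔clY x) (⊆-cl x∈X)
      ∣X∣≤d : ∣ X ∣ ≤ d
      ∣X∣≤d = nonspanning⇒∣X∣≤d HX p∉clX
      ∣Y∣≤d : ∣ Y ∣ ≤ d
      ∣Y∣≤d = nonspanning⇒∣X∣≤d HY (p∉clX ∘ from (clX⇔clY p))

    module _ (paving : Paving S d) where

      paving-small-independent : ∀ {W} → ∣ W ∣ ≤ d → H W
      paving-small-independent {W} ∣W∣≤d with extend-to-size W ∣W∣≤d (<⇒≤ d<n)
      ... | W′ , W⊆W′ , ∣W′∣≡d = downClosed W⊆W′ (paving W′ ∣W′∣≡d)

      paving-small-isFlat : ∀ {X} → ∣ X ∣ < d → IsFlat S X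
      paving-small-isFlat ∣X∣<d I q _ I⊆X _ = paving-small-independent
        (≤-trans (∣p∪⁅x⁆∣≤1+∣p∣ I q) (≤-trans (s≤s (p⊆q⇒∣p∣≤∣q∣ I⊆X)) ∣X∣<d))

      paving⇒nearMatroid : NearMatroid S
      paving⇒nearMatroid = nearMatroid-if-spanBounded ≤-refl
        λ _ _ ∣X∣<d → flat-spanBound (paving-small-isFlat ∣X∣<d)

module _ {n m : ℕ} (S : SimplicialComplex n) (M : Fin m → Fin n → Bool) where
  open SimplicialComplex S

  SameColumn : Fin n → Fin n → Set
  SameColumn a b = ∀ r → M r a ≡ M r b

  sameColumn? : ∀ a b → Dec (SameColumn a b)
  sameColumn? a b = all? λ r → M r a Bool.≟ M r b

  columnClass : Fin n → Subset n
  columnClass x = tabulate λ a → does (sameColumn? a x)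

  ∈columnClass⇔ : ∀ {a x} → a ∈ columnClass x ⇔ SameColumn a x
  ∈columnClass⇔ {a} {x} = mk⇔
    (λ a∈ → does≡true⇒ (sameColumn? a x) (to ∈tabulate⇔ a∈))
    (λ same → from ∈tabulate⇔ (dec-true (sameColumn? a x) same))

  module _ {k} {r : Fin k → Fin m} {c : Fin k → Fin n}
           (diagonal : ∀ i → M (r i) (c i) ≡ true)
           (above : ∀ i j → i Fin.< j → M (r i) (c j) ≡ false) where

    unitriangular-sameColumn⇒≡ : ∀ {i j} → SameColumn (c i) (c j) → i ≡ j
    unitriangular-sameColumn⇒≡ = <-excluded⇒≡ (λ same ρ → sym (same ρ))
      λ {i} {j} i<j same → contradiction (trans (sym (diagonal i)) (trans (same (r i)) (above i j i<j))) λ ()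

    unitriangular-rows-injective : Injective _≡_ _≡_ r
    unitriangular-rows-injective = <-excluded⇒≡ sym
      λ {i} {j} i<j rᵢ≡rⱼ → contradiction
        (trans (sym (diagonal j)) (trans (cong (λ ρ → M ρ (c j)) (sym rᵢ≡rⱼ)) (above i j i<j))) λ ()

  lowerUnitriangularOn : ∀ {k X} (r : Fin k → Fin m) (c : Fin k → Fin n) →
    (∀ q → q ∈ X ⇔ ∃ λ j → c j ≡ q) →
    (∀ i → M (r i) (c i) ≡ true) → (∀ i j → i Fin.< j → M (r i) (c j) ≡ false) →
    LowerUnitriangularOn S M X
  lowerUnitriangularOn {k} r c X⇔image diagonal above =
    k , r , c , unitriangular-rows-injective diagonal above ,
    (λ cᵢ≡cⱼ → unitriangular-sameColumn⇒≡ diagonal above λ ρ → cong (M ρ) cᵢ≡cⱼ) ,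
    X⇔image , diagonal , above

  lowerUnitriangularOn-pair : ∀ {r₁ r₂ a b} → M r₁ a ≡ true → M r₁ b ≡ false → M r₂ b ≡ true →
                              LowerUnitriangularOn S M (⁅ a ⁆ ∪ ⁅ b ⁆)
  lowerUnitriangularOn-pair {r₁} {r₂} {a} {b} r₁a r₁b r₂b =
    lowerUnitriangularOn (lookup (r₁ ∷ r₂ ∷ [])) (lookup (a ∷ b ∷ [])) (λ q → mk⇔ (index q) element)
      diagonal above
    where
    index : ∀ q → q ∈ ⁅ a ⁆ ∪ ⁅ b ⁆ → ∃ λ j → lookup (a ∷ b ∷ []) j ≡ q
    index q q∈ with x∈p∪q⁻ ⁅ a ⁆ ⁅ b ⁆ q∈
    ... | inj₁ q∈⁅a⁆ = zero , sym (x∈⁅y⁆⇒x≡y a q∈⁅a⁆)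
    ... | inj₂ q∈⁅b⁆ = suc zero , sym (x∈⁅y⁆⇒x≡y b q∈⁅b⁆)
    element : ∀ {q} → (∃ λ j → lookup (a ∷ b ∷ []) j ≡ q) → q ∈ ⁅ a ⁆ ∪ ⁅ b ⁆
    element (zero , refl) = x∈p∪q⁺ (inj₁ (x∈⁅x⁆ a))
    element (suc zero , refl) = x∈p∪q⁺ (inj₂ (x∈⁅x⁆ b))
    diagonal : ∀ i → M (lookup (r₁ ∷ r₂ ∷ []) i) (lookup (a ∷ b ∷ []) i) ≡ true
    diagonal zero = r₁a
    diagonal (suc zero) = r₂b
    above : ∀ i j → i Fin.< j → M (lookup (r₁ ∷ r₂ ∷ []) i) (lookup (a ∷ b ∷ []) j) ≡ false
    above zero (suc zero) _ = r₁b
    above (suc zero) (suc zero) (s≤s ())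

  module _ (represents : ∀ X → H X ⇔ LowerUnitriangularOn S M X) where

    column-nonzero : ∀ a → ∃ λ r → M r a ≡ true
    column-nonzero a with to (represents ⁅ a ⁆) (singletons a)
    ... | _ , r , c , _ , _ , ⁅a⁆⇔image , diagonal , _ with to (⁅a⁆⇔image a) (x∈⁅x⁆ a)
    ...   | j , refl = r j , diagonal j

    differentColumns-independent : ∀ {a b} → ¬ SameColumn a b → H (⁅ a ⁆ ∪ ⁅ b ⁆)
    differentColumns-independent {a} {b} a≁b
      with ¬∀⟶∃¬ m _ (λ ρ → M ρ a Bool.≟ M ρ b) a≁b
    ... | ρ , ρa≢ρb with M ρ a in ρa | M ρ b in ρb
    ...   | true | false = from (represents _)
                             (lowerUnitriangularOn-pair ρa ρb (proj₂ (column-nonzero b)))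
    ...   | false | true = subst H (∪-comm ⁅ b ⁆ ⁅ a ⁆) (from (represents _)
                             (lowerUnitriangularOn-pair ρb ρa (proj₂ (column-nonzero a))))
    ...   | true | true = contradiction refl ρa≢ρb
    ...   | false | false = contradiction refl ρa≢ρb

    independent⊆columnClass⇒≡ : ∀ {I x a b} → H I → I ⊆ columnClass x → a ∈ I → b ∈ I → a ≡ b
    independent⊆columnClass⇒≡ {I} {x} {a} {b} HI I⊆class a∈I b∈I
      with to (represents I) HI
    ... | _ , r , c , _ , _ , I⇔image , diagonal , above
      with to (I⇔image a) a∈I | to (I⇔image b) b∈I
    ...   | i , refl | j , refl = cong c (unitriangular-sameColumn⇒≡ diagonal above
            λ ρ → trans (to ∈columnClass⇔ (I⊆class a∈I) ρ) (sym (to ∈columnClass⇔ (I⊆class b∈I) ρ)))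

    columnClass-isFlat : ∀ x → IsFlat S (columnClass x)
    columnClass-isFlat x I q HI I⊆class q∉class with nonempty? I
    ... | no I-empty = Empty∪⁅q⁆-independent S q I-empty
    ... | yes (y , y∈I) = downClosed I∪⁅q⁆⊆ (differentColumns-independent y≁q)
      where
      y≁q : ¬ SameColumn y q
      y≁q y∼q = q∉class (from ∈columnClass⇔ λ ρ → trans (sym (y∼q ρ)) (to ∈columnClass⇔ (I⊆class y∈I) ρ))
      I∪⁅q⁆⊆ : I ∪ ⁅ q ⁆ ⊆ ⁅ y ⁆ ∪ ⁅ q ⁆
      I∪⁅q⁆⊆ p∈ with x∈p∪q⁻ I ⁅ q ⁆ p∈
      ... | inj₁ p∈I = x∈p∪q⁺ (inj₁ (subst (_∈ ⁅ y ⁆)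
                         (independent⊆columnClass⇒≡ HI I⊆class y∈I p∈I) (x∈⁅x⁆ y)))
      ... | inj₂ p∈⁅q⁆ = x∈p∪q⁺ (inj₂ p∈⁅q⁆)

    representation-spanBounded : SpanBoundedBelow S 2
    representation-spanBounded {X} {Y} _ HY ∣X∣<2 Y⊆clX with <2⇒≡0⊎≡1 ∣X∣<2
    ... | inj₁ ∣X∣≡0 = flat-spanBound S (Empty-isFlat S (∣p∣≡0⇒Empty ∣X∣≡0)) Y⊆clX
    ... | inj₂ ∣X∣≡1 with ∣p∣≡1⇒⊆⁅x⁆ ∣X∣≡1
    ...   | x , X⊆⁅x⁆ = subst (∣ Y ∣ ≤_) (sym ∣X∣≡1) (subsingleton⇒∣p∣≤1
            (independent⊆columnClass⇒≡ HY Y⊆class))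
      where
      X⊆class : X ⊆ columnClass x
      X⊆class = ⊆-trans X⊆⁅x⁆ (x∈p⇒⁅x⁆⊆p (from ∈columnClass⇔ λ _ → refl))
      Y⊆class : Y ⊆ columnClass x
      Y⊆class y∈Y = Y⊆clX y∈Y (columnClass x) (columnClass-isFlat x) X⊆class

booleanRepresentable⇒nearMatroid : ∀ {n d} (S : SimplicialComplex n) → HasDim S d →
                                   BooleanRepresentable S → d ≤ 2 → NearMatroid S
booleanRepresentable⇒nearMatroid S dim (_ , M , represents) d≤2 =
  nearMatroid-if-spanBounded S dim d≤2 (representation-spanBounded S M represents)

proposition7p6 : ∀ (n : ℕ) (S : SimplicialComplex (suc n)) (d : ℕ) → HasDim S d →
    (Paving S d → NearMatroid S) × (BooleanRepresentable S → d ≤ 2 → NearMatroid S)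
proposition7p6 n S d dim = paving⇒nearMatroid S dim , booleanRepresentable⇒nearMatroid S dim
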